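{- Let $\mathfrak g\ge1$, $r\ge0$ and integers $1<m_1\le\dots\le m_r$. Let $\Gamma$ be the group with generators $x_1,\dots,x_r,a_1,\dots,a_{\mathfrak g}$ and relations $\prod_{i=1}^r x_i\prod_{k=1}^{\mathfrak g}a_k^2=1$, $x_i^{m_i}=1$. Then for every integer $d\ge1$ the number of order- and sign-preserving homomorphisms $\Gamma\to\mathbb{Z}_{2d}$ is $$\mathrm{Hom}_o^+(\Gamma,\mathbb{Z}_{2d})=\begin{cases} d^{\mathfrak g-1}\prod_{i=1}^r\phi(m_i) & \text{if } d \text{ is odd and } m_i\mid d \text{ for all } i,\\ 2d^{\mathfrak g-1}\prod_{i=1}^r\phi(m_i) & \text{if } d \text{ is even, } m_i\mid d \text{ for all } i, \text{ and } \sum_{i=1}^r d/m_i\equiv \mathfrak g \pmod 2,\\ 0 & \text{otherwise.}\end{cases}$$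
   Context: A homomorphism $\psi:\Gamma\to\mathbb{Z}_{2d}$ is order-preserving if $\psi(x_i)$ has order exactly $m_i$ for every $i$. Sign structures: $\sigma:\Gamma\to\{\pm1\}$ with $\sigma(x_i)=+1$, $\sigma(a_k)=-1$; on $\mathbb{Z}_{2d}$ the sign is $+1$ on even and $-1$ on odd residues; $\psi$ is sign-preserving if it intertwines the two sign maps, i.e. each $\psi(x_i)$ is even and each $\psi(a_k)$ is odd. $\phi$ is Euler's totient function. -}

module Defs where

open import Data.Nat using (ℕ; zero; suc; _+_; _*_; _^_; _≟_; _≤_; _<_; _∸_)
open import Data.Nat.Divisibility using (_∣_; _∣?_; quotient)
open import Data.Nat.GCD using (gcd)
open import Data.Fin using (Fin; toℕ)
open import Data.Vec using (Vec; []; _∷_; lookup)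
open import Data.Vec.Relation.Unary.All using (All; []; _∷_; all?)
open import Data.List using (List; length; filter; map; upTo)
open import Data.Product using (_×_)
open import Relation.Nullary using (¬_; yes; no)
open import Relation.Binary.PropositionalEquality using (_≡_)
open import Data.List.Relation.Unary.Unique.Propositional using (Unique)
open import Data.List.Membership.Propositional using (_∈_)
open import Function.Bundles using (_⇔_)
open import Data.Product using (∃)

-- The number of x : A with P x is N: there is a duplicate-free list of
-- length N whose members are exactly the x with P x.
-- (Avoids comparing proofs of P, which would need function extensionality.)
NumberOf : (A : Set) → (A → Set) → ℕ → Set
NumberOf A P N = ∃ λ (L : List A) → (length L ≡ N) × Unique L × (∀ x → (x ∈ L) ⇔ P x)

φ : ℕ → ℕ
φ m = length (filter (λ k → gcd k m ≟ 1) (map suc (upTo m)))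

-- Z_n is modelled by Fin n (residues 0,…,n-1), with addition mod n.
-- "u ≡ 0 in Z_n" for a natural number u is  n ∣ u.

HasOrder : (n : ℕ) → Fin n → ℕ → Set
HasOrder n k m = 1 ≤ m × (n ∣ m * toℕ k) × (∀ j → 1 ≤ j → j < m → ¬ (n ∣ j * toℕ k))

-- Even / odd residues (sign +1 / -1); well defined since n = 2d is even.
Even : ℕ → Set
Even u = 2 ∣ u

sumV : ∀ {l} → Vec ℕ l → ℕ
sumV [] = 0
sumV (u ∷ us) = u + sumV us

prodV : ∀ {l} → Vec ℕ l → ℕ
prodV [] = 1
prodV (u ∷ us) = u * prodV us

toℕs : ∀ {n l} → Vec (Fin n) l → Vec ℕ l
toℕs [] = []
toℕs (k ∷ ks) = toℕ k ∷ toℕs ks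

mapφ : ∀ {l} → Vec ℕ l → Vec ℕ l
mapφ [] = []
mapφ (u ∷ us) = φ u ∷ mapφ us

-- A homomorphism Γ → Z_{2d} (Z_{2d} abelian) is the same as an assignment
-- of images x : Vec (Fin (2d)) r to x_1..x_r and a : Vec (Fin (2d)) g to
-- a_1..a_g satisfying the defining relations of Γ:
--   Σ x_i + 2 Σ a_k ≡ 0   and   m_i x_i ≡ 0.
IsHom : (d r g : ℕ) → Vec ℕ r → Vec (Fin (2 * d)) r → Vec (Fin (2 * d)) g → Set
IsHom d r g m x a =
  ((2 * d) ∣ (sumV (toℕs x) + 2 * sumV (toℕs a)))
  × (∀ i → (2 * d) ∣ (lookup m i * toℕ (lookup x i)))

OrderPreserving : (d r g : ℕ) → Vec ℕ r → Vec (Fin (2 * d)) r → Vec (Fin (2 * d)) g → Set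
OrderPreserving d r g m x a = ∀ i → HasOrder (2 * d) (lookup x i) (lookup m i)

SignPreserving : (d r g : ℕ) → Vec (Fin (2 * d)) r → Vec (Fin (2 * d)) g → Set
SignPreserving d r g x a =
  (∀ i → Even (toℕ (lookup x i))) × (∀ k → ¬ Even (toℕ (lookup a k)))

sumQuot : ∀ {l} (d : ℕ) (m : Vec ℕ l) → All (λ mi → mi ∣ d) m → ℕ
sumQuot d [] [] = 0
sumQuot d (mi ∷ m) (p ∷ ps) = quotient p + sumQuot d m ps

expectedCount : (d r g : ℕ) → Vec ℕ r → ℕ
expectedCount d r g m with all? (λ mi → mi ∣? d) m
... | no _ = 0
... | yes ps with 2 ∣? d
...   | no _ = d ^ (g ∸ 1) * prodV (mapφ m)
...   | yes _ with 2 ∣? (sumQuot d m ps + g)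
...     | yes _ = 2 * d ^ (g ∸ 1) * prodV (mapφ m)
...     | no _ = 0

{-# OPTIONS --safe #-}
module Submission where

-- A sign- and order-preserving homomorphism is a pair (x, a) of vectors over ℤ/2d with every
-- xᵢ = 2yᵢ even of order mᵢ, every aₖ odd, and Σ xᵢ + 2 Σ aₖ ≡ 0 (mod 2d), i.e.
-- Σ yᵢ + Σ aₖ ≡ 0 (mod d).  The even element 2y has order m in ℤ/2d iff y has order m in ℤ/d,
-- which forces m ∣ d and y = (d/m) u with u a unit modulo m: φ(mᵢ) choices for xᵢ.  Given x,
-- the odd a₁ … a_{g-1} are free (d choices each) and a_g is one of the two residues c, c + d
-- of ℤ/2d solving the congruence.  For odd d exactly one of them is odd.  For even d both have
-- the parity of Σ yᵢ + g - 1, and yᵢ ≡ d/mᵢ (mod 2) (if d/mᵢ is odd then mᵢ is even, so u is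
-- odd), so both are odd iff Σ d/mᵢ ≡ g (mod 2), and otherwise neither is.

open import Defs
open import Data.Empty using (⊥-elim)
open import Data.Fin using (Fin; zero; suc; toℕ; fromℕ<) renaming (_≤_ to _≤ᶠ_)
open import Data.Fin.Properties using (toℕ<n; toℕ-injective; toℕ-fromℕ<)
open import Data.List using (List; []; _∷_; length; map; _++_; filter; upTo)
open import Data.List.Membership.Propositional using (_∈_)
open import Data.List.Membership.Propositional.Properties
  using (∈-map⁺; ∈-map⁻; ∈-++⁺ˡ; ∈-++⁺ʳ; ∈-++⁻; ∈-filter⁺; ∈-filter⁻; ∈-upTo⁺; ∈-upTo⁻)
open import Data.List.Properties using (length-map; length-++; length-upTo)
open import Data.List.Relation.Unary.All as All using (All; []; _∷_)
import Data.List.Relation.Unary.All.Properties as All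
open import Data.List.Relation.Unary.Any using (here; there)
open import Data.List.Relation.Unary.Unique.Propositional using (Unique; []; _∷_)
open import Data.List.Relation.Unary.Unique.Propositional.Properties using (++⁺; map⁺; filter⁺; upTo⁺; Unique[x∷xs]⇒x∉xs)
open import Data.Nat
  using (ℕ; zero; suc; _+_; _*_; _^_; _∸_; _≤_; _<_; _≟_; _≤?_; z≤n; s≤s; z<s; parity;
         NonZero; >-nonZero; >-nonZero⁻¹; ≢-nonZero; ≢-nonZero⁻¹)
open import Data.Nat.Coprimality as Coprime using (Coprime; coprime-divisor; gcd≡1⇒coprime; coprime⇒gcd≡1; 0-coprimeTo-m⇒m≡1)
open import Data.Nat.Divisibility
open import Data.Nat.DivMod using (_%_; _/_; _mod_; m%n<n; m≡m%n+[m/n]*n; m<n⇒m%n≡m; m*n/n≡m; m*[n/m]≡n)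
open import Data.Nat.GCD using (gcd; gcd[m,n]∣m; gcd[m,n]∣n; gcd-greatest; c*gcd[m,n]≡gcd[cm,cn]; gcd[m,n]≡0⇒n≡0)
open import Data.Nat.Properties
open import Algebra.Properties.CommutativeSemigroup *-commutativeSemigroup using () renaming (x∙yz≈y∙xz to *-left-comm)
open import Data.Parity.Base using (0ℙ; 1ℙ)
import Data.Parity.Base as ℙ
import Data.Parity.Properties as ℙ
open import Data.Product as Product using (_×_; _,_; proj₁; proj₂; ∃; ∃₂)
open import Data.Sum as Sum using (_⊎_; inj₁; inj₂; [_,_]′)
open import Data.Vec using (Vec; []; _∷_; lookup)
open import Data.Vec.Properties using (∷-injective; ∷-injectiveˡ)
open import Data.Vec.Relation.Unary.All using ([]; _∷_; all?) renaming (All to Allᵥ)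
open import Data.Vec.Relation.Unary.All.Properties using (lookup⁺; lookup⁻)
open import Function using (_∘_; id)
open import Function.Bundles using (_⇔_; mk⇔; Equivalence)
open import Function.Properties.Equivalence using () renaming (trans to ⇔-trans; sym to ⇔-sym)
open import Relation.Binary.PropositionalEquality
  using (_≡_; _≢_; refl; sym; trans; cong; cong₂; subst; subst₂; module ≡-Reasoning)
open import Relation.Nullary using (¬_; contradiction; yes; no)

open Equivalence using (to; from)

private variable
  A B : Set
  P Q : A → Set
  n : ℕ

numberOf-cong : (∀ x → P x ⇔ Q x) → NumberOf A P n → NumberOf A Q n
numberOf-cong P⇔Q (xs , len , unique , ∈⇔P) =
  xs , len , unique , λ x → mk⇔ (to (P⇔Q x) ∘ to (∈⇔P x)) (from (∈⇔P x) ∘ from (P⇔Q x))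

numberOf-∅ : (∀ x → ¬ P x) → NumberOf A P 0
numberOf-∅ ¬P = [] , refl , [] , λ x → mk⇔ (λ ()) (⊥-elim ∘ ¬P x)

numberOf-[_] : ∀ {e} → P e → (∀ x → P x → x ≡ e) → NumberOf A P 1
numberOf-[_] {e = e} Pe unique = e ∷ [] , refl , [] ∷ [] , λ x → mk⇔ (λ { (here refl) → Pe }) (here ∘ unique x)

numberOf-pair : ∀ {e₀ e₁} → e₀ ≢ e₁ → P e₀ → P e₁ → (∀ x → P x → x ≡ e₀ ⊎ x ≡ e₁)
  → NumberOf A P 2
numberOf-pair e₀≢e₁ Pe₀ Pe₁ cases =
  _ , refl , (e₀≢e₁ ∷ []) ∷ [] ∷ [] ,
  λ x → mk⇔ (λ { (here refl) → Pe₀ ; (there (here refl)) → Pe₁ })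
            ([ here , there ∘ here ]′ ∘ cases x)

numberOf-image : (f : A → B) → NumberOf A P n
  → (∀ {x y} → P x → P y → f x ≡ f y → x ≡ y)
  → (∀ {x} → P x → Q (f x))
  → (∀ {y} → Q y → ∃ λ x → P x × f x ≡ y)
  → NumberOf B Q n
numberOf-image {P = P} {Q = Q} f (xs , len , unique , ∈⇔P) f-inj P⇒Q Q⇒P =
  map f xs , trans (length-map f xs) len , map-unique (All.tabulate (to (∈⇔P _))) unique ,
  λ y → mk⇔ (∈⇒Q y) (Q⇒∈ y)
  where
  map-unique : ∀ {ys} → All P ys → Unique ys → Unique (map f ys)
  map-unique [] [] = []
  map-unique (Py ∷ Pys) (y∉ys ∷ unique) =
    All.map⁺ (All.zipWith (λ (Py′ , y≢y′) → y≢y′ ∘ f-inj Py Py′) (Pys , y∉ys)) ∷ map-unique Pys unique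
  ∈⇒Q : ∀ y → y ∈ map f xs → Q y
  ∈⇒Q y y∈ with ∈-map⁻ f y∈
  ... | x , x∈ , refl = P⇒Q (to (∈⇔P x) x∈)
  Q⇒∈ : ∀ y → Q y → y ∈ map f xs
  Q⇒∈ y Qy with Q⇒P Qy
  ... | x , Px , refl = ∈-map⁺ f (from (∈⇔P x) Px)

module _ {Q : A → B → Set} {b : ℕ} where

  private
    Fibre : A → Set
    Fibre x = NumberOf B (Q x) b

  pairs : ∀ {xs} → All Fibre xs → List (A × B)
  pairs [] = []
  pairs {xs = x ∷ _} ((ys , _) ∷ fibres) = map (x ,_) ys ++ pairs fibres

  length-pairs : ∀ {xs} (fibres : All Fibre xs) → length (pairs fibres) ≡ length xs * b
  length-pairs [] = refl
  length-pairs {xs = x ∷ xs} ((ys , len , _) ∷ fibres) = begin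
    length (map (x ,_) ys ++ pairs fibres)        ≡⟨ length-++ (map (x ,_) ys) ⟩
    length (map (x ,_) ys) + length (pairs fibres) ≡⟨ cong₂ _+_ (trans (length-map (x ,_) ys) len) (length-pairs fibres) ⟩
    b + length xs * b                              ∎
    where open ≡-Reasoning

  ∈-pairs⁺ : ∀ {xs x y} (fibres : All Fibre xs) → x ∈ xs → Q x y → (x , y) ∈ pairs fibres
  ∈-pairs⁺ ((ys , _ , _ , ∈⇔Q) ∷ fibres) (here refl) Qxy = ∈-++⁺ˡ (∈-map⁺ _ (from (∈⇔Q _) Qxy))
  ∈-pairs⁺ ((ys , _) ∷ fibres) (there x∈xs) Qxy = ∈-++⁺ʳ (map _ ys) (∈-pairs⁺ fibres x∈xs Qxy)

  ∈-pairs⁻ : ∀ {xs x y} (fibres : All Fibre xs) → (x , y) ∈ pairs fibres → x ∈ xs × Q x y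
  ∈-pairs⁻ ((ys , _ , _ , ∈⇔Q) ∷ fibres) xy∈ with ∈-++⁻ (map _ ys) xy∈
  ... | inj₁ xy∈ys with ∈-map⁻ _ xy∈ys
  ...   | y , y∈ys , refl = here refl , to (∈⇔Q y) y∈ys
  ∈-pairs⁻ (_ ∷ fibres) xy∈ | inj₂ xy∈pairs = Product.map₁ there (∈-pairs⁻ fibres xy∈pairs)

  pairs-unique : ∀ {xs} (fibres : All Fibre xs) → Unique xs → Unique (pairs fibres)
  pairs-unique [] [] = []
  pairs-unique {xs = x ∷ _} ((ys , _ , ys-unique , _) ∷ fibres) unique@(_ ∷ xs-unique) =
    ++⁺ (map⁺ (cong proj₂) ys-unique) (pairs-unique fibres xs-unique) disjoint
    where
    disjoint : ∀ {v} → ¬ (v ∈ map (x ,_) ys × v ∈ pairs fibres)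
    disjoint (v∈ys , v∈pairs) with ∈-map⁻ _ v∈ys
    ... | _ , _ , refl = Unique[x∷xs]⇒x∉xs unique (proj₁ (∈-pairs⁻ fibres v∈pairs))

numberOf-Σ : ∀ {Q : A → B → Set} {a b} → NumberOf A P a → (∀ x → P x → NumberOf B (Q x) b)
  → NumberOf (A × B) (λ (x , y) → P x × Q x y) (a * b)
numberOf-Σ {B = B} {Q = Q} {b = b} (xs , len , unique , ∈⇔P) fibre =
  pairs fibres , trans (length-pairs fibres) (cong (_* b) len) , pairs-unique fibres unique ,
  λ (x , y) → mk⇔ (Product.map₁ (to (∈⇔P x)) ∘ ∈-pairs⁻ fibres)
                  (λ (Px , Qxy) → ∈-pairs⁺ fibres (from (∈⇔P x) Px) Qxy)
  where
  fibres : All (λ x → NumberOf B (Q x) b) xs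
  fibres = All.tabulate (λ {x} x∈xs → fibre x (to (∈⇔P x) x∈xs))

numberOf-∷ : ∀ {l a b} {Q : A → Vec A l → Set} → NumberOf A P a → (∀ x → P x → NumberOf (Vec A l) (Q x) b)
  → NumberOf (Vec A (suc l)) (λ { (x ∷ v) → P x × Q x v }) (a * b)
numberOf-∷ heads tails =
  numberOf-image (λ (x , v) → x ∷ v) (numberOf-Σ heads tails)
    (λ _ _ → Product.uncurry (cong₂ _,_) ∘ ∷-injective)
    id
    (λ { {x ∷ v} P×Q → (x , v) , P×Q , refl })

numberOf-Π : ∀ {r} {P : Fin r → A → Set} (ns : Vec ℕ r) → (∀ i → NumberOf A (P i) (lookup ns i))
  → NumberOf (Vec A r) (λ v → ∀ i → P i (lookup v i)) (prodV ns)
numberOf-Π [] _ = numberOf-[ (λ ()) ] (λ { [] _ → refl })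
numberOf-Π (n ∷ ns) count =
  numberOf-cong (λ { (x ∷ v) → mk⇔ (λ { (Px , Pv) zero → Px ; (Px , Pv) (suc i) → Pv i })
                                    (λ Pxv → Pxv zero , Pxv ∘ suc) })
    (numberOf-∷ (count zero) (λ _ _ → numberOf-Π ns (count ∘ suc)))

upTo-numberOf : ∀ d → NumberOf ℕ (_< d) d
upTo-numberOf d = upTo d , length-upTo d , upTo⁺ d , λ _ → mk⇔ ∈-upTo⁻ ∈-upTo⁺

even⇒parity≡0ℙ : Even n → parity n ≡ 0ℙ
even⇒parity≡0ℙ (divides q refl) = trans (ℙ.*-homo-* q 2) (ℙ.*-zeroʳ (parity q))

parity≡0ℙ⇒even : ∀ n → parity n ≡ 0ℙ → Even n
parity≡0ℙ⇒even zero _ = 2 ∣0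
parity≡0ℙ⇒even (suc (suc n)) parity≡0ℙ = ∣m∣n⇒∣m+n ∣-refl (parity≡0ℙ⇒even n parity≡0ℙ)

even⇔parity≡0ℙ : Even n ⇔ parity n ≡ 0ℙ
even⇔parity≡0ℙ = mk⇔ even⇒parity≡0ℙ (parity≡0ℙ⇒even _)

¬even⇔parity≡1ℙ : (¬ Even n) ⇔ parity n ≡ 1ℙ
¬even⇔parity≡1ℙ {n} = mk⇔ to′ (λ odd even → 1ℙ≢0ℙ (trans (sym odd) (even⇒parity≡0ℙ even)))
  where
  1ℙ≢0ℙ : 1ℙ ≢ 0ℙ
  1ℙ≢0ℙ ()
  to′ : ¬ Even n → parity n ≡ 1ℙ
  to′ ¬even with parity n in eq
  ... | 0ℙ = ⊥-elim (¬even (parity≡0ℙ⇒even n eq))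
  ... | 1ℙ = refl

parity≡1ℙ⇒≡1+2* : ∀ n → parity n ≡ 1ℙ → ∃ λ h → n ≡ 1 + 2 * h
parity≡1ℙ⇒≡1+2* 1 _ = 0 , refl
parity≡1ℙ⇒≡1+2* (suc (suc n)) odd with parity≡1ℙ⇒≡1+2* n odd
... | h , refl = suc h , cong suc (sym (*-suc 2 h))

parity[1+2*n]≡1ℙ : ∀ n → parity (1 + 2 * n) ≡ 1ℙ
parity[1+2*n]≡1ℙ n = trans (ℙ.+-homo-+ 1 (2 * n)) (cong (1ℙ ℙ.+_) (ℙ.*-homo-* 2 n))

p+q≡0ℙ⇔p≡q : ∀ p q → p ℙ.+ q ≡ 0ℙ ⇔ p ≡ q
p+q≡0ℙ⇔p≡q p q = mk⇔ (to′ p q) (λ { refl → ℙ.p+p≡0ℙ p })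
  where
  to′ : ∀ p q → p ℙ.+ q ≡ 0ℙ → p ≡ q
  to′ 0ℙ 0ℙ _ = refl
  to′ 1ℙ 1ℙ _ = refl

even[m+n]⇔parity≡ : ∀ m n → Even (m + n) ⇔ parity m ≡ parity n
even[m+n]⇔parity≡ m n =
  ⇔-trans even⇔parity≡0ℙ (⇔-trans (mk⇔ (trans (sym (ℙ.+-homo-+ m n))) (trans (ℙ.+-homo-+ m n)))
                                   (p+q≡0ℙ⇔p≡q (parity m) (parity n)))

_hasOrder_mod_ : ℕ → ℕ → ℕ → Set
k hasOrder m mod n = 1 ≤ m × n ∣ m * k × (∀ j → 1 ≤ j → j < m → ¬ (n ∣ j * k))

hasOrder-cong : ∀ {k k′ m n n′} → (∀ j → n ∣ j * k ⇔ n′ ∣ j * k′)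
  → k hasOrder m mod n ⇔ k′ hasOrder m mod n′
hasOrder-cong ∣⇔∣ = mk⇔ (transport (to ∘ ∣⇔∣) (from ∘ ∣⇔∣)) (transport (from ∘ ∣⇔∣) (to ∘ ∣⇔∣))
  where
  transport : ∀ {k k′ m n n′} → (∀ j → n ∣ j * k → n′ ∣ j * k′) → (∀ j → n′ ∣ j * k′ → n ∣ j * k)
    → k hasOrder m mod n → k′ hasOrder m mod n′
  transport {m = m} forth back (1≤m , n∣mk , minimal) =
    1≤m , forth m n∣mk , λ j 1≤j j<m → minimal j 1≤j j<m ∘ back j

hasOrder-*-cancel : ∀ c {k m n} .{{_ : NonZero c}} → (c * k) hasOrder m mod (c * n) ⇔ k hasOrder m mod n
hasOrder-*-cancel c {k} {n = n} = hasOrder-cong λ j →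
  mk⇔ (*-cancelˡ-∣ c ∘ subst (c * n ∣_) (*-left-comm j c k))
      (subst (c * n ∣_) (sym (*-left-comm j c k)) ∘ *-monoʳ-∣ c)

coprime⇒hasOrder : ∀ {u m} .{{_ : NonZero m}} → Coprime u m → u hasOrder m mod m
coprime⇒hasOrder {u} {m} coprime = >-nonZero⁻¹ m , m∣m*n u , m∤ju
  where
  m∤ju : ∀ j → 1 ≤ j → j < m → ¬ (m ∣ j * u)
  m∤ju j 1≤j j<m m∣ju =
    <⇒≱ j<m (∣⇒≤ {{>-nonZero 1≤j}} (coprime-divisor (Coprime.sym coprime) (subst (m ∣_) (*-comm j u) m∣ju)))

-- A common divisor t of u and m = b t gives m ∣ b u, so minimality forces b = m, i.e. t = 1.
hasOrder⇒coprime : ∀ {u m} .{{_ : NonZero m}} → u hasOrder m mod m → Coprime u m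
hasOrder⇒coprime {u} {m} (_ , _ , minimal) {t} (divides a u≡a*t , divides b m≡b*t) =
  *-cancelˡ-≡ t 1 m (begin
    m * t ≡⟨ cong (_* t) (sym b≡m) ⟩
    b * t ≡⟨ sym m≡b*t ⟩
    m     ≡⟨ sym (*-identityʳ m) ⟩
    m * 1 ∎)
  where
  open ≡-Reasoning
  m∣b*u : m ∣ b * u
  m∣b*u = divides a (begin
    b * u       ≡⟨ cong (b *_) u≡a*t ⟩
    b * (a * t) ≡⟨ *-left-comm b a t ⟩
    a * (b * t) ≡⟨ cong (a *_) (sym m≡b*t) ⟩
    a * m       ∎)
  b≢0 : b ≢ 0
  b≢0 refl = ≢-nonZero⁻¹ m m≡b*t
  b≡m : b ≡ m
  b≡m = ≤-antisym (∣⇒≤ (divides t (trans m≡b*t (*-comm b t))))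
                  (≮⇒≥ λ b<m → minimal b (n≢0⇒n>0 b≢0) b<m m∣b*u)

-- n ∣ gcd(m, n) k, so by minimality gcd(m, n) = m.
hasOrder⇒∣ : ∀ {k m n} .{{_ : NonZero n}} → k hasOrder m mod n → m ∣ n
hasOrder⇒∣ {k} {m} {n} (1≤m , n∣m*k , minimal) = subst (_∣ n) t≡m (gcd[m,n]∣n m n)
  where
  instance
    _ : NonZero m
    _ = >-nonZero 1≤m
  t : ℕ
  t = gcd m n
  n∣t*k : n ∣ t * k
  n∣t*k = subst (n ∣_) (trans (sym (c*gcd[m,n]≡gcd[cm,cn] k m n)) (*-comm k t))
                (gcd-greatest (subst (n ∣_) (*-comm m k) n∣m*k) (n∣m*n k))
  t≢0 : t ≢ 0
  t≢0 = ≢-nonZero⁻¹ n ∘ gcd[m,n]≡0⇒n≡0 m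
  t≡m : t ≡ m
  t≡m = ≤-antisym (∣⇒≤ (gcd[m,n]∣m m n)) (≮⇒≥ λ t<m → minimal t (n≢0⇒n>0 t≢0) t<m n∣t*k)

-- φ m counts the 1 ≤ u ≤ m with gcd u m ≡ 1; for m > 1 these are the u < m coprime to m, since 0 and m are not.
φ-numberOf : ∀ m → 1 < m → NumberOf ℕ (λ u → u < m × Coprime u m) (φ m)
φ-numberOf m 1<m =
  _ , refl , filter⁺ (λ k → gcd k m ≟ 1) (map⁺ suc-injective (upTo⁺ m)) , λ u → mk⇔ ∈⇒ (⇐∈ u)
  where
  ¬coprime[m,m] : ¬ Coprime m m
  ¬coprime[m,m] coprime = <⇒≢ 1<m (sym (coprime (∣-refl , ∣-refl)))
  ∈⇒ : ∀ {u} → u ∈ filter (λ k → gcd k m ≟ 1) (map suc (upTo m)) → u < m × Coprime u m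
  ∈⇒ u∈ with ∈-filter⁻ (λ k → gcd k m ≟ 1) {xs = map suc (upTo m)} u∈
  ... | u∈range , gcd≡1 with ∈-map⁻ suc {xs = upTo m} u∈range
  ...   | i , i∈upTo , refl =
    ≤∧≢⇒< (∈-upTo⁻ i∈upTo) (λ { refl → ¬coprime[m,m] coprime }) , coprime
    where
    coprime : Coprime _ m
    coprime = gcd≡1⇒coprime gcd≡1
  ⇐∈ : ∀ u → u < m × Coprime u m → u ∈ filter (λ k → gcd k m ≟ 1) (map suc (upTo m))
  ⇐∈ zero (_ , coprime) = ⊥-elim (<⇒≢ 1<m (sym (0-coprimeTo-m⇒m≡1 coprime)))
  ⇐∈ (suc i) (u<m , coprime) =
    ∈-filter⁺ (λ k → gcd k m ≟ 1) {xs = map suc (upTo m)} (∈-map⁺ suc (∈-upTo⁺ (<⇒≤ u<m)))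
              (coprime⇒gcd≡1 coprime)

module _ {m n} (m∣n : m ∣ n) .{{_ : NonZero n}} where

  private
    q : ℕ
    q = quotient m∣n
    n≡q*m : n ≡ q * m
    n≡q*m = m∣n⇒n≡quotient*m m∣n
    instance
      q-nonZero : NonZero q
      q-nonZero = quotient≢0 m∣n
      m-nonZero : NonZero m
      m-nonZero = ≢-nonZero λ m≡0 → ≢-nonZero⁻¹ n (0∣⇒≡0 (subst (_∣ n) m≡0 m∣n))

  hasOrder⇒coprime-multiple : ∀ {k} → k < n → k hasOrder m mod n → ∃ λ u → (u < m × Coprime u m) × k ≡ q * u
  hasOrder⇒coprime-multiple {k} k<n order@(_ , n∣m*k , _) = u , (u<m , coprime) , k≡q*u
    where
    q∣k : q ∣ k
    q∣k = *-cancelʳ-∣ m (subst₂ _∣_ n≡q*m (*-comm m k) n∣m*k)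
    u : ℕ
    u = quotient q∣k
    k≡q*u : k ≡ q * u
    k≡q*u = m∣n⇒n≡m*quotient q∣k
    u<m : u < m
    u<m = *-cancelˡ-< q u m (subst₂ _<_ k≡q*u n≡q*m k<n)
    coprime : Coprime u m
    coprime = hasOrder⇒coprime (to (hasOrder-*-cancel q) (subst₂ (λ k n → k hasOrder m mod n) k≡q*u n≡q*m order))

  coprime-multiple-hasOrder : ∀ {u} → Coprime u m → (q * u) hasOrder m mod n
  coprime-multiple-hasOrder coprime =
    subst ((q * _) hasOrder m mod_) (sym n≡q*m) (from (hasOrder-*-cancel q) (coprime⇒hasOrder coprime))

  hasOrder-numberOf : 1 < m → NumberOf ℕ (λ k → k < n × k hasOrder m mod n) (φ m)
  hasOrder-numberOf 1<m = numberOf-image (q *_) (φ-numberOf m 1<m)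
    (λ _ _ → *-cancelˡ-≡ _ _ q)
    (λ (u<m , coprime) → subst (q * _ <_) (sym n≡q*m) (*-monoʳ-< q u<m) , coprime-multiple-hasOrder coprime)
    (λ (k<n , order) → let u , u-props , k≡q*u = hasOrder⇒coprime-multiple k<n order in u , u-props , sym k≡q*u)

  -- k = q u with u a unit modulo m; if q is odd then m is even (as n = q m is), so u is odd.
  hasOrder⇒parity≡quotient : ∀ {k} → Even n → k < n → k hasOrder m mod n → parity k ≡ parity q
  hasOrder⇒parity≡quotient n-even k<n order with hasOrder⇒coprime-multiple k<n order
  ... | u , (_ , coprime) , refl = trans (ℙ.*-homo-* q u) absorb
    where
    u-odd : parity q ≡ 1ℙ → parity u ≡ 1ℙ
    u-odd q-odd = to ¬even⇔parity≡1ℙ λ 2∣u → contradiction (coprime (2∣u , 2∣m)) λ ()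
      where
      2∣m : 2 ∣ m
      2∣m = parity≡0ℙ⇒even m (begin
        parity m             ≡⟨ cong (ℙ._* parity m) q-odd ⟨
        parity q ℙ.* parity m ≡⟨ ℙ.*-homo-* q m ⟨
        parity (q * m)       ≡⟨ cong parity n≡q*m ⟨
        parity n             ≡⟨ even⇒parity≡0ℙ n-even ⟩
        0ℙ                   ∎)
        where open ≡-Reasoning
    absorb : parity q ℙ.* parity u ≡ parity q
    absorb with parity q in q-parity
    ... | 0ℙ = refl
    ... | 1ℙ = u-odd q-parity

parity[sum]-odd : ∀ {n l} (a : Vec (Fin n) l) → (∀ k → parity (toℕ (lookup a k)) ≡ 1ℙ)
  → parity (sumV (toℕs a)) ≡ parity l
parity[sum]-odd [] _ = refl
parity[sum]-odd {l = suc l} (a ∷ v) odd =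
  trans (ℙ.+-homo-+ (toℕ a) _)
        (trans (cong₂ ℙ._+_ (odd zero) (parity[sum]-odd v (odd ∘ suc))) (sym (ℙ.+-homo-+ 1 l)))

lookup-mapφ : ∀ {r} (m : Vec ℕ r) i → lookup (mapφ m) i ≡ φ (lookup m i)
lookup-mapφ (_ ∷ _) zero = refl
lookup-mapφ (_ ∷ m) (suc i) = lookup-mapφ m i

-- For even xᵢ = 2 yᵢ this is Σ yᵢ, and 2d ∣ Σ xᵢ + 2 Σ aₖ becomes d ∣ Σ yᵢ + Σ aₖ.
halfSum : ∀ {n l} → Vec (Fin n) l → ℕ
halfSum [] = 0
halfSum (k ∷ x) = toℕ k / 2 + halfSum x

sum≡2*halfSum : ∀ {n l} (x : Vec (Fin n) l) → (∀ i → Even (toℕ (lookup x i))) → sumV (toℕs x) ≡ 2 * halfSum x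
sum≡2*halfSum [] _ = refl
sum≡2*halfSum (k ∷ x) even =
  trans (cong₂ _+_ (sym (m*[n/m]≡n (even zero))) (sum≡2*halfSum x (even ∘ suc)))
        (sym (*-distribˡ-+ 2 (toℕ k / 2) (halfSum x)))

module ℤ/2d (d : ℕ) .{{_ : NonZero d}} where

  instance
    2d-nonZero : NonZero (2 * d)
    2d-nonZero = m*n≢0 2 d

  b+2*y<2*d⇒y<d : ∀ {b y} → b + 2 * y < 2 * d → y < d
  b+2*y<2*d⇒y<d {b} {y} b+2y<2d = *-cancelˡ-< 2 y d (≤-<-trans (m≤n+m (2 * y) b) b+2y<2d)

  numberOf-b+2* : ∀ b {P : ℕ → Set} {N} → b < 2 → (∀ {y} → P y → y < d) → NumberOf ℕ P N
    → NumberOf (Fin (2 * d)) (λ k → ∃ λ y → toℕ k ≡ b + 2 * y × P y) N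
  numberOf-b+2* b {P} b<2 P⇒<d count = numberOf-image embed count
    (λ Px Py eq → *-cancelˡ-≡ _ _ 2 (+-cancelˡ-≡ b _ _
      (trans (sym (toℕ-embed Px)) (trans (cong toℕ eq) (toℕ-embed Py)))))
    (λ Py → _ , toℕ-embed Py , Py)
    (λ (y , k≡b+2y , Py) → y , Py , toℕ-injective (trans (toℕ-embed Py) (sym k≡b+2y)))
    where
    embed : ℕ → Fin (2 * d)
    embed y = (b + 2 * y) mod (2 * d)
    b+2y<2d : ∀ {y} → y < d → b + 2 * y < 2 * d
    b+2y<2d {y} y<d = ≤-trans (+-monoˡ-< (2 * y) b<2) (subst (_≤ 2 * d) (*-suc 2 y) (*-monoʳ-≤ 2 y<d))
    toℕ-embed : ∀ {y} → P y → toℕ (embed y) ≡ b + 2 * y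
    toℕ-embed Py = trans (toℕ-fromℕ< _) (m<n⇒m%n≡m (b+2y<2d (P⇒<d Py)))

  odd-numberOf : NumberOf (Fin (2 * d)) (λ k → parity (toℕ k) ≡ 1ℙ) d
  odd-numberOf = numberOf-cong (λ k → mk⇔ (odd k) (1+2*half k)) (numberOf-b+2* 1 (s≤s (s≤s z≤n)) id (upTo-numberOf d))
    where
    odd : ∀ k → (∃ λ y → toℕ k ≡ 1 + 2 * y × y < d) → parity (toℕ k) ≡ 1ℙ
    odd k (y , k≡1+2y , _) = trans (cong parity k≡1+2y) (parity[1+2*n]≡1ℙ y)
    1+2*half : ∀ k → parity (toℕ k) ≡ 1ℙ → ∃ λ y → toℕ k ≡ 1 + 2 * y × y < d
    1+2*half k k-odd with parity≡1ℙ⇒≡1+2* _ k-odd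
    ... | y , k≡1+2y = y , k≡1+2y , b+2*y<2*d⇒y<d {1} (subst (_< 2 * d) k≡1+2y (toℕ<n k))

  EvenOfOrder : ℕ → Fin (2 * d) → Set
  EvenOfOrder m k = Even (toℕ k) × HasOrder (2 * d) k m

  evenOfOrder⇔half : ∀ {m k} → EvenOfOrder m k ⇔ (∃ λ y → toℕ k ≡ 2 * y × (y < d × y hasOrder m mod d))
  evenOfOrder⇔half {m} {k} = mk⇔
    (λ (divides y k≡y*2 , order) → let k≡2y = trans k≡y*2 (*-comm y 2) in
      y , k≡2y , b+2*y<2*d⇒y<d {0} (subst (_< 2 * d) k≡2y (toℕ<n k)) ,
      to (hasOrder-*-cancel 2) (subst (_hasOrder m mod (2 * d)) k≡2y order))
    (λ (y , k≡2y , _ , order) →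
      divides y (trans k≡2y (*-comm 2 y)) , subst (_hasOrder m mod (2 * d)) (sym k≡2y) (from (hasOrder-*-cancel 2) order))

  evenOfOrder-numberOf : ∀ {m} → 1 < m → m ∣ d → NumberOf (Fin (2 * d)) (EvenOfOrder m) (φ m)
  evenOfOrder-numberOf 1<m m∣d =
    numberOf-cong (λ _ → ⇔-sym evenOfOrder⇔half) (numberOf-b+2* 0 z<s proj₁ (hasOrder-numberOf m∣d 1<m))

  evenOfOrder⇒∣ : ∀ {m k} → EvenOfOrder m k → m ∣ d
  evenOfOrder⇒∣ evenOfOrder = let _ , _ , _ , order = to evenOfOrder⇔half evenOfOrder in hasOrder⇒∣ order

  evenOfOrder⇒parity[half] : ∀ {m k} → Even d → (m∣d : m ∣ d) → EvenOfOrder m k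
    → parity (toℕ k / 2) ≡ parity (quotient m∣d)
  evenOfOrder⇒parity[half] {k = k} d-even m∣d evenOfOrder with to evenOfOrder⇔half evenOfOrder
  ... | y , k≡2y , y<d , order =
    trans (cong parity k/2≡y) (hasOrder⇒parity≡quotient m∣d d-even y<d order)
    where
    k/2≡y : toℕ k / 2 ≡ y
    k/2≡y = trans (cong (_/ 2) (trans k≡2y (*-comm 2 y))) (m*n/n≡m y 2)

  -- d s ∸ s is a representative of -s modulo d that truncated subtraction does not spoil.
  complement : ∀ s → ∃ λ c → c < d × d ∣ s + c
  complement s = w % d , m%n<n w d , ∣m+n∣m⇒∣n (subst (d ∣_) d*s≡ (m∣m*n s)) (n∣m*n (w / d))
    where
    open ≡-Reasoning
    w : ℕ
    w = d * s ∸ s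
    d*s≡ : d * s ≡ w / d * d + (s + w % d)
    d*s≡ = begin
      d * s                   ≡⟨ m+[n∸m]≡n (m≤n*m s d) ⟨
      s + w                   ≡⟨ cong (s +_) (m≡m%n+[m/n]*n w d) ⟩
      s + (w % d + w / d * d) ≡⟨ +-assoc s _ _ ⟨
      (s + w % d) + w / d * d ≡⟨ +-comm _ (w / d * d) ⟩
      w / d * d + (s + w % d) ∎

  ∣[s+x]∧∣[s+y]⇒∣[y∸x] : ∀ {s x y} → x ≤ y → d ∣ s + x → d ∣ s + y → d ∣ y ∸ x
  ∣[s+x]∧∣[s+y]⇒∣[y∸x] {s} {x} {y} x≤y d∣s+x d∣s+y = ∣m+n∣m⇒∣n (subst (d ∣_) s+y≡ d∣s+y) d∣s+x
    where
    s+y≡ : s + y ≡ (s + x) + (y ∸ x)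
    s+y≡ = trans (cong (s +_) (sym (m+[n∸m]≡n x≤y))) (sym (+-assoc s x (y ∸ x)))

  ∣∧<2*⇒≡0⊎≡ : ∀ {x} → d ∣ x → x < 2 * d → x ≡ 0 ⊎ x ≡ d
  ∣∧<2*⇒≡0⊎≡ (divides zero refl) _ = inj₁ refl
  ∣∧<2*⇒≡0⊎≡ (divides 1 refl) _ = inj₂ (+-identityʳ d)
  ∣∧<2*⇒≡0⊎≡ (divides (suc (suc q)) refl) x<2d =
    contradiction x<2d (≤⇒≯ (*-monoˡ-≤ d {2} {suc (suc q)} (s≤s (s≤s z≤n))))

  ∣[s+a]⇒a≡c⊎a≡c+d : ∀ {s c a} → c < d → d ∣ s + c → a < 2 * d → d ∣ s + a → a ≡ c ⊎ a ≡ c + d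
  ∣[s+a]⇒a≡c⊎a≡c+d {s} {c} {a} c<d d∣s+c a<2d d∣s+a with c ≤? a
  ... | yes c≤a =
    Sum.map (λ a∸c≡0 → trans (a≡c+ a∸c≡0) (+-identityʳ c)) a≡c+ (∣∧<2*⇒≡0⊎≡ d∣a∸c (≤-<-trans (m∸n≤m a c) a<2d))
    where
    d∣a∸c : d ∣ a ∸ c
    d∣a∸c = ∣[s+x]∧∣[s+y]⇒∣[y∸x] c≤a d∣s+c d∣s+a
    a≡c+ : ∀ {x} → a ∸ c ≡ x → a ≡ c + x
    a≡c+ eq = trans (sym (m+[n∸m]≡n c≤a)) (cong (c +_) eq)
  ... | no c≰a = contradiction (∣⇒≤ {{>-nonZero (m<n⇒0<n∸m a<c)}} d∣c∸a) (<⇒≱ (≤-<-trans (m∸n≤m c a) c<d))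
    where
    a<c : a < c
    a<c = ≰⇒> c≰a
    d∣c∸a : d ∣ c ∸ a
    d∣c∸a = ∣[s+x]∧∣[s+y]⇒∣[y∸x] (<⇒≤ a<c) d∣s+a d∣s+c

  roots : ∀ s → ∃₂ λ (lo hi : Fin (2 * d)) → lo ≢ hi × parity (toℕ hi) ≡ parity (toℕ lo) ℙ.+ parity d
                                          × (∀ a → d ∣ s + toℕ a ⇔ (a ≡ lo ⊎ a ≡ hi))
  roots s with complement s
  ... | c , c<d , d∣s+c = lo , hi , lo≢hi , parity[hi] , λ a → mk⇔ (root⇒ a) root⇐
    where
    lo hi : Fin (2 * d)
    lo = fromℕ< (≤-trans c<d (m≤m+n d (d + 0)))
    hi = fromℕ< (subst (c + d <_) (cong (d +_) (sym (+-identityʳ d))) (+-monoˡ-< d c<d))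
    toℕ-lo : toℕ lo ≡ c
    toℕ-lo = toℕ-fromℕ< _
    toℕ-hi : toℕ hi ≡ c + d
    toℕ-hi = toℕ-fromℕ< _
    lo≢hi : lo ≢ hi
    lo≢hi lo≡hi = <⇒≢ (m<m+n c (>-nonZero⁻¹ d)) (trans (sym toℕ-lo) (trans (cong toℕ lo≡hi) toℕ-hi))
    parity[hi] : parity (toℕ hi) ≡ parity (toℕ lo) ℙ.+ parity d
    parity[hi] = trans (cong parity toℕ-hi) (trans (ℙ.+-homo-+ c d) (cong (ℙ._+ parity d) (cong parity (sym toℕ-lo))))
    root⇒ : ∀ a → d ∣ s + toℕ a → a ≡ lo ⊎ a ≡ hi
    root⇒ a d∣s+a = Sum.map (λ eq → toℕ-injective (trans eq (sym toℕ-lo)))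
                            (λ eq → toℕ-injective (trans eq (sym toℕ-hi)))
                            (∣[s+a]⇒a≡c⊎a≡c+d c<d d∣s+c (toℕ<n a) d∣s+a)
    root⇐ : ∀ {a} → a ≡ lo ⊎ a ≡ hi → d ∣ s + toℕ a
    root⇐ (inj₁ refl) = subst (λ x → d ∣ s + x) (sym toℕ-lo) d∣s+c
    root⇐ (inj₂ refl) =
      subst (λ x → d ∣ s + x) (sym toℕ-hi) (subst (d ∣_) (+-assoc s c d) (∣m∣n⇒∣m+n d∣s+c ∣-refl))

  OddRoot : ℕ → Fin (2 * d) → Set
  OddRoot s a = parity (toℕ a) ≡ 1ℙ × d ∣ s + toℕ a

  oddRoot-numberOf-odd : parity d ≡ 1ℙ → ∀ s → NumberOf (Fin (2 * d)) (OddRoot s) 1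
  oddRoot-numberOf-odd d-odd s with roots s
  ... | lo , hi , _ , parity[hi] , roots⇔ with parity (toℕ lo) in lo-parity
  ...   | 1ℙ = numberOf-[ lo-parity , from (roots⇔ lo) (inj₁ refl) ] λ a (a-odd , d∣s+a) →
                 [ id , (λ { refl → contradiction (trans (sym a-odd) (trans parity[hi] (cong (1ℙ ℙ.+_) d-odd))) λ () }) ]′
                 (to (roots⇔ a) d∣s+a)
  ...   | 0ℙ = numberOf-[ trans parity[hi] d-odd , from (roots⇔ hi) (inj₂ refl) ] λ a (a-odd , d∣s+a) →
                 [ (λ { refl → contradiction (trans (sym a-odd) lo-parity) λ () }) , id ]′ (to (roots⇔ a) d∣s+a)

  oddRoot-numberOf-even : parity d ≡ 0ℙ → ∀ s → parity s ≡ 1ℙ → NumberOf (Fin (2 * d)) (OddRoot s) 2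
  oddRoot-numberOf-even d-even s s-odd with roots s
  ... | lo , hi , lo≢hi , parity[hi] , roots⇔ =
    numberOf-pair lo≢hi (lo-odd , d∣s+lo) (hi-odd , from (roots⇔ hi) (inj₂ refl))
                  (λ a (_ , d∣s+a) → to (roots⇔ a) d∣s+a)
    where
    d∣s+lo : d ∣ s + toℕ lo
    d∣s+lo = from (roots⇔ lo) (inj₁ refl)
    lo-odd : parity (toℕ lo) ≡ 1ℙ
    lo-odd = trans (sym (to (even[m+n]⇔parity≡ s (toℕ lo)) (∣-trans (parity≡0ℙ⇒even d d-even) d∣s+lo))) s-odd
    hi-odd : parity (toℕ hi) ≡ 1ℙ
    hi-odd = trans parity[hi] (cong₂ ℙ._+_ lo-odd d-even)

  OddSolution : ∀ {l} → ℕ → Vec (Fin (2 * d)) l → Set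
  OddSolution s a = (∀ k → parity (toℕ (lookup a k)) ≡ 1ℙ) × d ∣ s + sumV (toℕs a)

  oddSolution-[_] : ∀ {s n} → NumberOf (Fin (2 * d)) (OddRoot s) n → NumberOf (Vec (Fin (2 * d)) 1) (OddSolution s) n
  oddSolution-[_] {s} roots = numberOf-image (_∷ []) roots (λ _ _ → ∷-injectiveˡ)
    (λ (odd , d∣s+a) → (λ { zero → odd }) , subst (λ x → d ∣ s + x) (sym (+-identityʳ _)) d∣s+a)
    (λ { {a ∷ []} (odd , d∣s+a) → a , (odd zero , subst (λ x → d ∣ s + x) (+-identityʳ _) d∣s+a) , refl })

  oddSolution-∷ : ∀ {l s b}
    → (∀ a → parity (toℕ a) ≡ 1ℙ → NumberOf (Vec (Fin (2 * d)) l) (OddSolution (s + toℕ a)) b)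
    → NumberOf (Vec (Fin (2 * d)) (suc l)) (OddSolution s) (d * b)
  oddSolution-∷ {s = s} tails = numberOf-cong
    (λ { (a ∷ v) → mk⇔
      (λ (a-odd , v-odd , d∣) → (λ { zero → a-odd ; (suc k) → v-odd k }) , subst (d ∣_) (+-assoc s (toℕ a) _) d∣)
      (λ (odd , d∣) → odd zero , odd ∘ suc , subst (d ∣_) (sym (+-assoc s (toℕ a) _)) d∣) })
    (numberOf-∷ odd-numberOf tails)

  oddSolution-numberOf-odd : ¬ Even d → ∀ g s → NumberOf (Vec (Fin (2 * d)) (suc g)) (OddSolution s) (d ^ g)
  oddSolution-numberOf-odd d-odd zero s = oddSolution-[ oddRoot-numberOf-odd (to ¬even⇔parity≡1ℙ d-odd) s ]
  oddSolution-numberOf-odd d-odd (suc g) s = oddSolution-∷ λ a _ → oddSolution-numberOf-odd d-odd g (s + toℕ a)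

  oddSolution-numberOf-even : Even d → ∀ g s → parity s ≡ parity (suc g)
    → NumberOf (Vec (Fin (2 * d)) (suc g)) (OddSolution s) (2 * d ^ g)
  oddSolution-numberOf-even d-even zero s s-odd = oddSolution-[ oddRoot-numberOf-even (even⇒parity≡0ℙ d-even) s s-odd ]
  oddSolution-numberOf-even d-even (suc g) s s≡g = subst (NumberOf _ _) (*-left-comm d 2 (d ^ g)) (oddSolution-∷ λ a a-odd →
    oddSolution-numberOf-even d-even g (s + toℕ a) (begin
      parity (s + toℕ a)        ≡⟨ ℙ.+-homo-+ s (toℕ a) ⟩
      parity s ℙ.+ parity (toℕ a) ≡⟨ cong₂ ℙ._+_ s≡g a-odd ⟩
      parity g ℙ.+ 1ℙ           ≡⟨ ℙ.+-comm (parity g) 1ℙ ⟩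
      1ℙ ℙ.+ parity g           ≡⟨ ℙ.+-homo-+ 1 g ⟨
      parity (suc g)            ∎))
    where open ≡-Reasoning

  oddSolution⇒parity≡ : ∀ {l} → Even d → ∀ s (a : Vec (Fin (2 * d)) l) → OddSolution s a → parity s ≡ parity l
  oddSolution⇒parity≡ d-even s a (odd , d∣) =
    trans (to (even[m+n]⇔parity≡ s _) (∣-trans d-even d∣)) (parity[sum]-odd a odd)

  EvenOfOrders : ∀ {r} → Vec ℕ r → Vec (Fin (2 * d)) r → Set
  EvenOfOrders m x = ∀ i → EvenOfOrder (lookup m i) (lookup x i)

  evenOfOrders-numberOf : ∀ {r} (m : Vec ℕ r) → (∀ i → 1 < lookup m i) → Allᵥ (_∣ d) m
    → NumberOf (Vec (Fin (2 * d)) r) (EvenOfOrders m) (prodV (mapφ m))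
  evenOfOrders-numberOf m 1<m m∣d = numberOf-Π (mapφ m) λ i →
    subst (NumberOf _ _) (sym (lookup-mapφ m i)) (evenOfOrder-numberOf (1<m i) (lookup⁺ m∣d i))

  parity[halfSum] : ∀ {r} {m : Vec ℕ r} → Even d → (m∣d : Allᵥ (_∣ d) m) → ∀ x → EvenOfOrders m x
    → parity (halfSum x) ≡ parity (sumQuot d m m∣d)
  parity[halfSum] d-even [] [] _ = refl
  parity[halfSum] d-even (mᵢ∣d ∷ m∣d) (k ∷ x) evenOfOrders = begin
    parity (toℕ k / 2 + halfSum x)
      ≡⟨ ℙ.+-homo-+ (toℕ k / 2) (halfSum x) ⟩
    parity (toℕ k / 2) ℙ.+ parity (halfSum x)
      ≡⟨ cong₂ ℙ._+_ (evenOfOrder⇒parity[half] d-even mᵢ∣d (evenOfOrders zero))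
                     (parity[halfSum] d-even m∣d x (evenOfOrders ∘ suc)) ⟩
    parity (quotient mᵢ∣d) ℙ.+ parity (sumQuot d _ m∣d)
      ≡⟨ ℙ.+-homo-+ (quotient mᵢ∣d) _ ⟨
    parity (quotient mᵢ∣d + sumQuot d _ m∣d)
      ∎
    where open ≡-Reasoning

  OrderSignHom : ∀ {r g} → Vec ℕ r → Vec (Fin (2 * d)) r × Vec (Fin (2 * d)) g → Set
  OrderSignHom {r} {g} m (x , a) = IsHom d r g m x a × OrderPreserving d r g m x a × SignPreserving d r g x a

  orderSignHom⇔ : ∀ {r g} (m : Vec ℕ r) (x : Vec (Fin (2 * d)) r) (a : Vec (Fin (2 * d)) g)
    → OrderSignHom m (x , a) ⇔ (EvenOfOrders m x × OddSolution (halfSum x) a)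
  orderSignHom⇔ m x a = mk⇔ to′ from′
    where
    relation≡ : (∀ i → Even (toℕ (lookup x i)))
      → sumV (toℕs x) + 2 * sumV (toℕs a) ≡ 2 * (halfSum x + sumV (toℕs a))
    relation≡ even = trans (cong (_+ 2 * sumV (toℕs a)) (sum≡2*halfSum x even)) (sym (*-distribˡ-+ 2 (halfSum x) _))
    to′ : OrderSignHom m (x , a) → EvenOfOrders m x × OddSolution (halfSum x) a
    to′ ((2d∣relation , _) , order , even , ¬even) =
      (λ i → even i , order i) , to ¬even⇔parity≡1ℙ ∘ ¬even ,
      *-cancelˡ-∣ 2 (subst (2 * d ∣_) (relation≡ even) 2d∣relation)
    from′ : EvenOfOrders m x × OddSolution (halfSum x) a → OrderSignHom m (x , a)
    from′ (evenOfOrders , odd , d∣) =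
      (subst (2 * d ∣_) (sym (relation≡ even)) (*-monoʳ-∣ 2 d∣) , (λ i → let _ , 2d∣mᵢxᵢ , _ = order i in 2d∣mᵢxᵢ)) ,
      order , even , from ¬even⇔parity≡1ℙ ∘ odd
      where
      even : ∀ i → Even (toℕ (lookup x i))
      even = proj₁ ∘ evenOfOrders
      order : OrderPreserving d _ _ m x a
      order = proj₂ ∘ evenOfOrders

  orderSignHom-numberOf : ∀ {r g b} (m : Vec ℕ r) → (∀ i → 1 < lookup m i) → Allᵥ (_∣ d) m
    → (∀ x → EvenOfOrders m x → NumberOf (Vec (Fin (2 * d)) g) (OddSolution (halfSum x)) b)
    → NumberOf (Vec (Fin (2 * d)) r × Vec (Fin (2 * d)) g) (OrderSignHom m) (b * prodV (mapφ m))
  orderSignHom-numberOf {b = b} m 1<m m∣d oddSolutions =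
    numberOf-cong (λ (x , a) → ⇔-sym (orderSignHom⇔ m x a))
      (subst (NumberOf _ _) (*-comm (prodV (mapφ m)) b) (numberOf-Σ (evenOfOrders-numberOf m 1<m m∣d) oddSolutions))

  no-orderSignHom : ∀ {r g} (m : Vec ℕ r)
    → (∀ x (a : Vec (Fin (2 * d)) g) → EvenOfOrders m x → ¬ OddSolution (halfSum x) a)
    → NumberOf (Vec (Fin (2 * d)) r × Vec (Fin (2 * d)) g) (OrderSignHom m) 0
  no-orderSignHom m impossible =
    numberOf-∅ λ (x , a) hom → Product.uncurry (impossible x a) (to (orderSignHom⇔ m x a) hom)

open ℤ/2d

proposition4 : (g r : ℕ) → 1 ≤ g → (m : Vec ℕ r)
    → (∀ i → 1 < lookup m i)
    → (∀ i j → i ≤ᶠ j → lookup m i ≤ lookup m j)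
    → (d : ℕ) → 1 ≤ d
    → NumberOf (Vec (Fin (2 * d)) r × Vec (Fin (2 * d)) g)
    (λ xa → IsHom d r g m (proj₁ xa) (proj₂ xa)
    × OrderPreserving d r g m (proj₁ xa) (proj₂ xa)
    × SignPreserving d r g (proj₁ xa) (proj₂ xa))
    (expectedCount d r g m)
proposition4 (suc g) r _ m 1<m _ d@(suc _) _ with all? (_∣? d) m
... | no ¬m∣d = no-orderSignHom d m λ _ _ evenOfOrders _ → ¬m∣d (lookup⁻ (evenOfOrder⇒∣ d ∘ evenOfOrders))
... | yes m∣d with 2 ∣? d
...   | no d-odd = orderSignHom-numberOf d m 1<m m∣d λ x _ →
          oddSolution-numberOf-odd d d-odd g (halfSum x)
...   | yes d-even with 2 ∣? (sumQuot d m m∣d + suc g)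
...     | yes Q≡g = orderSignHom-numberOf d m 1<m m∣d λ x evenOfOrders →
          oddSolution-numberOf-even d d-even g (halfSum x)
            (trans (parity[halfSum] d d-even m∣d x evenOfOrders) (to (even[m+n]⇔parity≡ _ (suc g)) Q≡g))
...     | no Q≢g = no-orderSignHom d m λ x a evenOfOrders solution → Q≢g (from (even[m+n]⇔parity≡ _ (suc g))
          (trans (sym (parity[halfSum] d d-even m∣d x evenOfOrders))
                 (oddSolution⇒parity≡ d d-even (halfSum x) a solution)))
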